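{- Let $C=\langle c_1,c_2,\ldots,c_n\rangle$ be a sequence of nonempty binary strings. Let $\alpha,\gamma\in\mathbf{H}$ be incomparable with respect to the subtree relation, and assume $\alpha$ is incomparable with every $\mathsf{g}_i$ with respect to $\sqsubseteq$. Let $\delta=\langle\alpha,\alpha\rangle$ and let $F^{\alpha}_{\delta}(L)=L[\alpha\mapsto\delta]$ for all $L\in\mathbf{H}$. Let $T\in\mathbf{H}$. Then $T\in\mathbb{P}(C,\alpha,\gamma)$ if and only if (1) $\delta\not\sqsubseteq T$; (2) there exists $m\in\{1,\ldots,n\}$ such that $\big\langle\gamma,\frac{c_m}{C,\alpha}\big\rangle\sqsubseteq T$; (3) there exists $S\in\tau_{\alpha}(\{0,1,\mu_1,\ldots,\mu_n\}^*)$ such that \[ T=\Big\langle F^{\alpha}_{\delta}(T)\Big[\big\langle\gamma,\tfrac{c_m}{C,\delta}\big\rangle\mapsto\gamma,\ \tfrac{c_1}{C,\delta}\mapsto\alpha,\ \ldots,\ \tfrac{c_n}{C,\delta}\mapsto\alpha\Big],\ S\Big\rangle . \]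
   Context: $\mathbf{H}$ is the set of finite full binary trees, i.e. variable-free terms built from the constant $\perp$ and the binary pairing $\langle\cdot,\cdot\rangle$; $\sqsubseteq$ is the subtree (subterm) relation. $t[r\mapsto s]$ is the tree obtained by replacing every occurrence of $r$ in $t$ by $s$, and $t[r_1\mapsto s_1,\ldots,r_k\mapsto s_k]$ abbreviates $t[r_1\mapsto s_1][r_2\mapsto s_2]\cdots[r_k\mapsto s_k]$. Notation: $\langle x_1\rangle=x_1$, $\langle x_1,\ldots,x_m,x_{m+1}\rangle=\langle\langle x_1,\ldots,x_m\rangle,x_{m+1}\rangle$; $\perp^1=\perp$, $\perp^{k+1}=\langle\perp^k,\perp\rangle$. For $i\ge1$ let $\mathsf{g}_i=\langle\perp^{3+i},\perp^{3+i}\rangle$. For a finite alphabet $\{a_1,\ldots,a_m\}$ (each letter $a_i$ identified with the tree $\mathsf{g}_i$, distinct letters getting distinct $\mathsf{g}_i$), the one-to-one map $\tau_\alpha$ from strings to $\mathbf{H}$ is defined by $\tau_\alpha(\varepsilon)=\alpha$, $\tau_\alpha(a_i)=\langle\alpha,\mathsf{g}_i\rangle$, and $\tau_\alpha(w_0w_1)=\tau_\alpha(w_0)[\alpha\mapsto\tau_\alpha(w_1)]$ when $w_0$ is a single letter; one writes $\frac{s}{\alpha}$ for $\tau_\alpha(s)$. Here the alphabet is $\{0,1,\mu_1,\ldots,\mu_n\}$ with $\mu_1,\ldots,\mu_n$ fresh letters. For each $i$, write $c_i=w_id$ with $d\in\{0,1\}$ the last letter and set $\frac{c_i}{C,\alpha}=\frac{w_i\mu_i}{\alpha}$;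 more generally $\frac{c_{i_1}\cdots c_{i_m}}{C,\alpha}=\frac{w_{i_1}\mu_{i_1}\cdots w_{i_m}\mu_{i_m}}{\alpha}$ and $\frac{\varepsilon}{C,\alpha}=\alpha$ (the same with $\delta$ in place of $\alpha$). $\mathbb{P}(C,\alpha,\gamma)$ is the smallest subset of $\mathbf{H}$ such that $\langle\gamma,\frac{c_i}{C,\alpha}\rangle\in\mathbb{P}(C,\alpha,\gamma)$ for all $i\in\{1,\ldots,n\}$, and if $T=\langle R,\frac{c_{i_1}\cdots c_{i_m}}{C,\alpha}\rangle\in\mathbb{P}(C,\alpha,\gamma)$ then $\langle T,\frac{c_{i_1}\cdots c_{i_m}c_j}{C,\alpha}\rangle\in\mathbb{P}(C,\alpha,\gamma)$ for all $j\in\{1,\ldots,n\}$. -}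

module Defs where

open import Data.Nat using (ℕ; zero; suc; _+_)
open import Data.Fin using (Fin; toℕ)
open import Data.Bool using (Bool; true; false; if_then_else_)
open import Data.List using (List; []; _∷_; _++_; [_]; foldl; allFin; concatMap; map)
open import Data.Product using (_×_; _,_)
open import Relation.Nullary using (Dec; yes; no; ¬_; does)
open import Relation.Binary.PropositionalEquality using (_≡_; refl; cong₂)

data H : Set where
  ⊥ₕ    : H
  ⟨_,_⟩ : H → H → H

data _⊑_ : H → H → Set where
  ⊑-refl : ∀ {t} → t ⊑ t
  ⊑-l    : ∀ {r s u} → r ⊑ s → r ⊑ ⟨ s , u ⟩
  ⊑-r    : ∀ {r s u} → r ⊑ u → r ⊑ ⟨ s , u ⟩

_≟H_ : (s t : H) → Dec (s ≡ t)
⊥ₕ ≟H ⊥ₕ = yes refl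
⊥ₕ ≟H ⟨ _ , _ ⟩ = no (λ ())
⟨ _ , _ ⟩ ≟H ⊥ₕ = no (λ ())
⟨ a , b ⟩ ≟H ⟨ c , d ⟩ with a ≟H c | b ≟H d
... | yes refl | yes refl = yes refl
... | no ne    | _        = no (λ { refl → ne refl })
... | yes _    | no ne    = no (λ { refl → ne refl })

_[_↦_] : H → H → H → H
t [ r ↦ s ] with does (t ≟H r)
... | true = s
_[_↦_] ⊥ₕ r s | false = ⊥ₕ
_[_↦_] ⟨ a , b ⟩ r s | false = ⟨ a [ r ↦ s ] , b [ r ↦ s ] ⟩

-- ⊥^(k+1) : botPow k ; so ⊥^1 = botPow 0 = ⊥.
botPow : ℕ → H
botPow zero = ⊥ₕ
botPow (suc k) = ⟨ botPow k , ⊥ₕ ⟩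

-- g i = ⟨ ⊥^(3+i) , ⊥^(3+i) ⟩   (used for i ≥ 1)
g : ℕ → H
g i = ⟨ botPow (2 + i) , botPow (2 + i) ⟩

data Letter (n : ℕ) : Set where
  b0 b1 : Letter n
  μ     : Fin n → Letter n

-- Identification of letters with trees: a₁ = 0, a₂ = 1, a_{2+i} = μᵢ.
code : ∀ {n} → Letter n → H
code b0    = g 1
code b1    = g 2
code (μ i) = g (3 + toℕ i)

τ : ∀ {n} → H → List (Letter n) → H
τ α []      = α
τ α (a ∷ w) = ⟨ α , code a ⟩ [ α ↦ τ α w ]

bit : ∀ {n} → Bool → Letter n
bit false = b0
bit true  = b1

dropLast : {A : Set} → List A → List A
dropLast []           = []
dropLast (x ∷ [])     = []
dropLast (x ∷ y ∷ xs) = x ∷ dropLast (y ∷ xs)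

Seq : ℕ → Set
Seq n = Fin n → List Bool

encOne : ∀ {n} → Seq n → Fin n → List (Letter n)
encOne C i = map bit (dropLast (C i)) ++ [ μ i ]

-- c_{i1}⋯c_{im} / (C, α)  =  τ_α(w_{i1} μ_{i1} ⋯ w_{im} μ_{im})
encC : ∀ {n} → Seq n → H → List (Fin n) → H
encC C α is = τ α (concatMap (encOne C) is)

data P {n : ℕ} (C : Seq n) (α γ : H) : H → Set where
  base : ∀ i → P C α γ ⟨ γ , encC C α [ i ] ⟩
  step : ∀ R i is j →
         P C α γ ⟨ R , encC C α (i ∷ is) ⟩ →
         P C α γ ⟨ ⟨ R , encC C α (i ∷ is) ⟩ , encC C α (i ∷ is ++ [ j ]) ⟩

-- t [ c₁/(C,δ) ↦ α , … , cₙ/(C,δ) ↦ α ]  (sequentially, i = 1,…,n)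
replAll : ∀ {n} → Seq n → H → H → H → H
replAll {n} C δ α t = foldl (λ u i → u [ encC C δ [ i ] ↦ α ]) t (allFin n)

Incomparable : H → H → Set
Incomparable s t = ¬ (s ⊑ t) × ¬ (t ⊑ s)

-- Under the incomparability hypotheses τ_α(w) is the left-nested chain
-- ⟨⋯⟨α , a_k⟩ ⋯ , a_1⟩ of the codes of w = a_1⋯a_k, in which δ = ⟨α , α⟩ does not
-- occur.  In a tree ⟨T′ , τ_α(u w_j μ_j)⟩ of 𝐏(C, α, γ), renaming α to δ turns the
-- right label into the δ-chain of u w_j μ_j; the replacements c_i/(C,δ) ↦ α then
-- cut off exactly its final block w_j μ_j and restore α (the letters μ_i make
-- that block unique), while the base pair ⟨γ , c_m/(C,δ)⟩ collapses back to γ.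
-- Applied along the whole left spine, the displayed equation thus recovers T′
-- from T.  Conversely, by induction on T, the equation forces the left subtree
-- of T to satisfy the same three conditions, with a right label one block
-- shorter.
module Submission where

open import Defs
open import Data.Nat using (ℕ; zero; suc; _+_; _≤_; s≤s; z≤n)
open import Data.Nat.Properties using (≤-refl; ≤-trans; m≤m+n; m≤n+m; n≤1+n; <-irrefl; suc-injective)
open import Data.Fin using (Fin; toℕ)
open import Data.Fin.Properties using (toℕ-injective)
open import Data.List using (List; []; _∷_; [_]; _++_; _∷ʳ_; foldl; allFin; concatMap; map)
open import Data.List.Properties using (++-assoc; ++-identityʳ; ++-cancelʳ; ++-conicalʳ; ∷ʳ-injective; concatMap-++)
open import Data.List.Membership.Propositional using (_∈_)
open import Data.List.Membership.Propositional.Properties using (∈-allFin)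
open import Data.List.Relation.Unary.Any using (here; there)
open import Data.Product using (Σ; _×_; _,_; proj₁; proj₂)
open import Data.Sum using (_⊎_; inj₁; inj₂)
open import Data.Empty using (⊥-elim)
open import Relation.Nullary using (¬_; Dec; yes; no)
open import Relation.Binary.PropositionalEquality
  using (_≡_; _≢_; refl; sym; trans; cong; cong₂; subst; module ≡-Reasoning)
open import Function.Bundles using (_⇔_; mk⇔)

size : H → ℕ
size ⊥ₕ = 1
size ⟨ a , b ⟩ = suc (size a + size b)

⊑-trans : ∀ {r s t} → r ⊑ s → s ⊑ t → r ⊑ t
⊑-trans p ⊑-refl = p
⊑-trans p (⊑-l q) = ⊑-l (⊑-trans p q)
⊑-trans p (⊑-r q) = ⊑-r (⊑-trans p q)

⊑-size : ∀ {r t} → r ⊑ t → size r ≤ size t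
⊑-size ⊑-refl = ≤-refl
⊑-size {t = ⟨ a , b ⟩} (⊑-l p) = ≤-trans (⊑-size p) (≤-trans (m≤m+n (size a) (size b)) (n≤1+n _))
⊑-size {t = ⟨ a , b ⟩} (⊑-r p) = ≤-trans (⊑-size p) (≤-trans (m≤n+m (size b) (size a)) (n≤1+n _))

pair⋢ˡ : ∀ {a b x} → x ⊑ a → ¬ (⟨ a , b ⟩ ⊑ x)
pair⋢ˡ {a} {b} p q =
  <-irrefl refl (≤-trans (s≤s (m≤m+n (size a) (size b))) (≤-trans (⊑-size q) (⊑-size p)))

pair⋢ʳ : ∀ {a b x} → x ⊑ b → ¬ (⟨ a , b ⟩ ⊑ x)
pair⋢ʳ {a} {b} p q =
  <-irrefl refl (≤-trans (s≤s (m≤n+m (size b) (size a))) (≤-trans (⊑-size q) (⊑-size p)))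

⊑-pair⁻ : ∀ {r a b} → r ⊑ ⟨ a , b ⟩ → r ≡ ⟨ a , b ⟩ ⊎ (r ⊑ a ⊎ r ⊑ b)
⊑-pair⁻ ⊑-refl = inj₁ refl
⊑-pair⁻ (⊑-l p) = inj₂ (inj₁ p)
⊑-pair⁻ (⊑-r p) = inj₂ (inj₂ p)

left right : H → H
left ⊥ₕ = ⊥ₕ
left ⟨ a , _ ⟩ = a
right ⊥ₕ = ⊥ₕ
right ⟨ _ , b ⟩ = b

↦-self : ∀ t s → t [ t ↦ s ] ≡ s
↦-self t s with t ≟H t
... | yes _ = refl
... | no t≢t = ⊥-elim (t≢t refl)

↦-pair : ∀ {a b r s} → ⟨ a , b ⟩ ≢ r → ⟨ a , b ⟩ [ r ↦ s ] ≡ ⟨ a [ r ↦ s ] , b [ r ↦ s ] ⟩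
↦-pair {a} {b} {r} ne with ⟨ a , b ⟩ ≟H r
... | yes e = ⊥-elim (ne e)
... | no _ = refl

↦-absent : ∀ {r s} t → ¬ (r ⊑ t) → t [ r ↦ s ] ≡ t
↦-absent {r} ⊥ₕ r⋢t with ⊥ₕ ≟H r
... | yes refl = ⊥-elim (r⋢t ⊑-refl)
... | no _ = refl
↦-absent {r} {s} ⟨ a , b ⟩ r⋢t =
  trans (↦-pair {a} {b} {r} {s} (λ { refl → r⋢t ⊑-refl }))
        (cong₂ ⟨_,_⟩ (↦-absent a (λ p → r⋢t (⊑-l p))) (↦-absent b (λ p → r⋢t (⊑-r p))))

↦-⊑-pair : ∀ {a b r s} → s ⊑ (a [ r ↦ s ]) ⊎ s ⊑ (b [ r ↦ s ]) → s ⊑ (⟨ a , b ⟩ [ r ↦ s ])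
↦-⊑-pair {a} {b} {r} p with ⟨ a , b ⟩ ≟H r
... | yes _ = ⊑-refl
... | no _ with p
...   | inj₁ q = ⊑-l q
...   | inj₂ q = ⊑-r q

↦-target⊑ : ∀ {r t} s → r ⊑ t → s ⊑ (t [ r ↦ s ])
↦-target⊑ {r} s ⊑-refl = subst (s ⊑_) (sym (↦-self r s)) ⊑-refl
↦-target⊑ s (⊑-l p) = ↦-⊑-pair (inj₁ (↦-target⊑ s p))
↦-target⊑ s (⊑-r p) = ↦-⊑-pair (inj₂ (↦-target⊑ s p))

↦-keeps : ∀ {r s t} → ¬ (r ⊑ s) → s ⊑ t → s ⊑ (t [ r ↦ s ])
↦-keeps {s = s} r⋢s ⊑-refl = subst (s ⊑_) (sym (↦-absent s r⋢s)) ⊑-refl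
↦-keeps r⋢s (⊑-l p) = ↦-⊑-pair (inj₁ (↦-keeps r⋢s p))
↦-keeps r⋢s (⊑-r p) = ↦-⊑-pair (inj₂ (↦-keeps r⋢s p))

botPow-injective : ∀ i j → botPow i ≡ botPow j → i ≡ j
botPow-injective zero zero _ = refl
botPow-injective (suc i) (suc j) e = cong suc (botPow-injective i j (cong left e))

g-injective : ∀ {i j} → g i ≡ g j → i ≡ j
g-injective {i} {j} e = suc-injective (suc-injective (botPow-injective (2 + i) (2 + j) (cong left e)))

index : ∀ {n} → Letter n → ℕ
index b0 = 1
index b1 = 2
index (μ i) = 3 + toℕ i

code≡g-index : ∀ {n} (a : Letter n) → code a ≡ g (index a)
code≡g-index b0 = refl
code≡g-index b1 = refl
code≡g-index (μ i) = refl

index-injective : ∀ {n} {a b : Letter n} → index a ≡ index b → a ≡ b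
index-injective {a = b0} {b0} _ = refl
index-injective {a = b1} {b1} _ = refl
index-injective {a = μ i} {μ j} e =
  cong μ (toℕ-injective (suc-injective (suc-injective (suc-injective e))))
index-injective {a = b0} {b1} ()
index-injective {a = b0} {μ _} ()
index-injective {a = b1} {b0} ()
index-injective {a = b1} {μ _} ()
index-injective {a = μ _} {b0} ()
index-injective {a = μ _} {b1} ()

code-injective : ∀ {n} {a b : Letter n} → code a ≡ code b → a ≡ b
code-injective {a = a} {b} e =
  index-injective (g-injective (trans (sym (code≡g-index a)) (trans e (code≡g-index b))))

CodeFree : ℕ → H → Set
CodeFree n t = (a : Letter n) → ¬ (t ⊑ code a)

CodeFree-⊑ : ∀ {n s t} → CodeFree n s → s ⊑ t → CodeFree n t
CodeFree-⊑ s-free s⊑t a t⊑a = s-free a (⊑-trans s⊑t t⊑a)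

ch : ∀ {n} → H → List (Letter n) → H
ch t [] = t
ch t (a ∷ w) = ⟨ ch t w , code a ⟩

module _ {n : ℕ} where

  ⊑-ch : ∀ {t} (w : List (Letter n)) → t ⊑ ch t w
  ⊑-ch [] = ⊑-refl
  ⊑-ch (a ∷ w) = ⊑-l (⊑-ch w)

  ch-++ : ∀ t (u v : List (Letter n)) → ch t (u ++ v) ≡ ch (ch t v) u
  ch-++ t [] v = refl
  ch-++ t (a ∷ u) v = cong ⟨_, code a ⟩ (ch-++ t u v)

  ch∷≢base : ∀ t (a : Letter n) w → ch t (a ∷ w) ≢ t
  ch∷≢base t a w e = pair⋢ˡ (⊑-ch w) (subst (ch t (a ∷ w) ⊑_) e ⊑-refl)

  ch-injective : ∀ {t} (u v : List (Letter n)) → ch t u ≡ ch t v → u ≡ v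
  ch-injective [] [] e = refl
  ch-injective {t} [] (a ∷ v) e = ⊥-elim (ch∷≢base t a v (sym e))
  ch-injective {t} (a ∷ u) [] e = ⊥-elim (ch∷≢base t a u e)
  ch-injective (a ∷ u) (b ∷ v) e =
    cong₂ _∷_ (code-injective (cong right e)) (ch-injective u v (cong left e))

  ch-rename : ∀ {t} s → CodeFree n t → (u : List (Letter n)) → ch t u [ t ↦ s ] ≡ ch s u
  ch-rename {t} s t-free [] = ↦-self t s
  ch-rename {t} s t-free (a ∷ u) =
    trans (↦-pair (ch∷≢base t a u))
          (cong₂ ⟨_,_⟩ (ch-rename s t-free u) (↦-absent (code a) (t-free a)))

  τ≡ch : ∀ {t} → CodeFree n t → (w : List (Letter n)) → τ t w ≡ ch t w
  τ≡ch t-free [] = refl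
  τ≡ch {t} t-free (a ∷ w) =
    trans (ch-rename (τ t w) t-free (a ∷ []))
          (cong ⟨_, code a ⟩ (τ≡ch t-free w))

  pair⊑ch⇒⊑base : ∀ {s x y t} → CodeFree n s → s ⊑ y → (w : List (Letter n)) →
                  ⟨ x , y ⟩ ⊑ ch t w → ⟨ x , y ⟩ ⊑ t
  pair⊑ch⇒⊑base s-free s⊑y [] p = p
  pair⊑ch⇒⊑base s-free s⊑y (a ∷ w) ⊑-refl = ⊥-elim (s-free a s⊑y)
  pair⊑ch⇒⊑base s-free s⊑y (a ∷ w) (⊑-l p) = pair⊑ch⇒⊑base s-free s⊑y w p
  pair⊑ch⇒⊑base s-free s⊑y (a ∷ w) (⊑-r p) = ⊥-elim (s-free a (⊑-trans s⊑y (⊑-trans (⊑-r ⊑-refl) p)))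

  pair≢ch : ∀ {s x y t} → CodeFree n s → s ⊑ y → (w : List (Letter n)) → w ≢ [] → ⟨ x , y ⟩ ≢ ch t w
  pair≢ch s-free s⊑y [] w≢[] = ⊥-elim (w≢[] refl)
  pair≢ch s-free s⊑y (a ∷ w) w≢[] e = s-free a (subst (_ ⊑_) (cong right e) s⊑y)

  ch-cut : ∀ {t} s → CodeFree n t → (v w : List (Letter n)) → v ≢ [] →
           ch t w [ ch t v ↦ s ] ≡ ch t w ⊎
           Σ (List (Letter n)) (λ u → w ≡ u ++ v × ch t w [ ch t v ↦ s ] ≡ ch s u)
  ch-cut s t-free [] w v≢[] = ⊥-elim (v≢[] refl)
  ch-cut {t} s t-free (a ∷ v) [] _ = inj₁ (↦-absent t (pair⋢ˡ (⊑-ch v)))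
  ch-cut {t} s t-free v (b ∷ w) v≢[] = cut-at (ch t (b ∷ w) ≟H ch t v)
    where
    code-kept : code b [ ch t v ↦ s ] ≡ code b
    code-kept = ↦-absent (code b) (CodeFree-⊑ t-free (⊑-ch v) b)
    cut-at : Dec (ch t (b ∷ w) ≡ ch t v) →
             ch t (b ∷ w) [ ch t v ↦ s ] ≡ ch t (b ∷ w) ⊎
             Σ (List (Letter n)) (λ u → b ∷ w ≡ u ++ v × ch t (b ∷ w) [ ch t v ↦ s ] ≡ ch s u)
    cut-at (yes e) = inj₂ ([] , ch-injective (b ∷ w) v e , trans (cong (_[ ch t v ↦ s ]) e) (↦-self _ s))
    cut-at (no ne) with ch-cut s t-free v w v≢[]
    ... | inj₁ e = inj₁ (trans (↦-pair ne) (cong₂ ⟨_,_⟩ e code-kept))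
    ... | inj₂ (u , w≡ , e) = inj₂ (b ∷ u , cong (b ∷_) w≡ , trans (↦-pair ne) (cong₂ ⟨_,_⟩ e code-kept))

  ch-cut-suffix : ∀ {t} s → CodeFree n t → (u v : List (Letter n)) →
                  ch t (u ++ v) [ ch t v ↦ s ] ≡ ch s u
  ch-cut-suffix {t} s t-free u v =
    trans (cong (_[ ch t v ↦ s ]) (ch-++ t u v)) (ch-rename s (CodeFree-⊑ t-free (⊑-ch v)) u)

module Characterisation {n : ℕ} (C : Seq n) (α γ : H)
                        (α⋢γ : ¬ (α ⊑ γ)) (γ⋢α : ¬ (γ ⊑ α)) (α-free : CodeFree n α) where

  δ : H
  δ = ⟨ α , α ⟩

  α⊑δ : α ⊑ δ
  α⊑δ = ⊑-l ⊑-refl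

  δ-free : CodeFree n δ
  δ-free = CodeFree-⊑ α-free α⊑δ

  δ⋢α : ¬ (δ ⊑ α)
  δ⋢α = pair⋢ˡ ⊑-refl

  δ⋢γ : ¬ (δ ⊑ γ)
  δ⋢γ p = α⋢γ (⊑-trans α⊑δ p)

  δ⋢τα : ∀ w → ¬ (δ ⊑ τ α w)
  δ⋢τα w p = δ⋢α (pair⊑ch⇒⊑base α-free ⊑-refl w (subst (δ ⊑_) (τ≡ch α-free w) p))

  α⊑τα : ∀ w → α ⊑ τ α w
  α⊑τα w = subst (α ⊑_) (sym (τ≡ch α-free w)) (⊑-ch w)

  τα-injective : ∀ u v → τ α u ≡ τ α v → u ≡ v
  τα-injective u v e = ch-injective u v (trans (sym (τ≡ch α-free u)) (trans e (τ≡ch α-free v)))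

  word : Fin n → List (Letter n)
  word k = concatMap (encOne C) [ k ]

  cα cδ : Fin n → H
  cα k = encC C α [ k ]
  cδ k = encC C δ [ k ]

  cδ≡ch : ∀ k → cδ k ≡ ch δ (word k)
  cδ≡ch k = τ≡ch δ-free (word k)

  δ⊑cδ : ∀ k → δ ⊑ cδ k
  δ⊑cδ k = subst (δ ⊑_) (sym (cδ≡ch k)) (⊑-ch (word k))

  word≡ : ∀ k → word k ≡ map bit (dropLast (C k)) ∷ʳ μ k
  word≡ k = ++-identityʳ _

  word≢[] : ∀ k → word k ≢ []
  word≢[] k e with ++-conicalʳ (map bit (dropLast (C k))) [ μ k ] (trans (sym (word≡ k)) e)
  ... | ()

  -- μ_k occurs in word k only as its last letter.
  word-suffix-unique : ∀ u v i j → u ++ word i ≡ v ++ word j → u ≡ v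
  word-suffix-unique u v i j e
    with ∷ʳ-injective (u ++ map bit (dropLast (C i))) (v ++ map bit (dropLast (C j)))
           (trans (sym (assoc u i)) (trans e (assoc v j)))
    where
    assoc : ∀ w k → w ++ word k ≡ (w ++ map bit (dropLast (C k))) ∷ʳ μ k
    assoc w k = trans (cong (w ++_) (word≡ k)) (sym (++-assoc w _ [ μ k ]))
  ... | p , refl = ++-cancelʳ _ u v p

  collapse : H → List (Fin n) → H
  collapse t ks = foldl (λ u k → u [ cδ k ↦ α ]) t ks

  cδ≢pair : ∀ {x y} k → α ⊑ y → ⟨ x , y ⟩ ≢ cδ k
  cδ≢pair k α⊑y e = pair≢ch α-free α⊑y (word k) (word≢[] k) (trans e (cδ≡ch k))

  collapse-pair : ∀ x y ks → α ⊑ y → collapse ⟨ x , y ⟩ ks ≡ ⟨ collapse x ks , collapse y ks ⟩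
  collapse-pair x y [] α⊑y = refl
  collapse-pair x y (k ∷ ks) α⊑y
    rewrite ↦-pair {x} {y} {cδ k} {α} (cδ≢pair k α⊑y)
    = collapse-pair _ _ ks (↦-keeps (λ p → δ⋢α (⊑-trans (δ⊑cδ k) p)) α⊑y)

  collapse-absent : ∀ t ks → (∀ k → ¬ (cδ k ⊑ t)) → collapse t ks ≡ t
  collapse-absent t [] cδ⋢t = refl
  collapse-absent t (k ∷ ks) cδ⋢t rewrite ↦-absent {s = α} t (cδ⋢t k) = collapse-absent t ks cδ⋢t

  -- The fold on the δ-chain of w either has not touched it yet, or has cut off
  -- a final block word i and renamed the remaining chain to an α-chain.
  Collapsed : List (Letter n) → H → Set
  Collapsed w t = Σ (List (Letter n)) (λ u → Σ (Fin n) (λ i → w ≡ u ++ word i × t ≡ ch α u))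

  Stage : List (Letter n) → H → Set
  Stage w t = t ≡ ch δ w ⊎ Collapsed w t

  collapsed-step : ∀ k {w t} → Collapsed w t → Collapsed w (t [ cδ k ↦ α ])
  collapsed-step k (u , i , w≡ , refl) =
    u , i , w≡ , ↦-absent (ch α u) (λ p → δ⋢τα u (subst (δ ⊑_) (sym (τ≡ch α-free u)) (⊑-trans (δ⊑cδ k) p)))

  ↦cδ≡↦ch : ∀ t k → t [ cδ k ↦ α ] ≡ t [ ch δ (word k) ↦ α ]
  ↦cδ≡↦ch t k = cong (λ r → t [ r ↦ α ]) (cδ≡ch k)

  stage-step : ∀ k {w t} → Stage w t → Stage w (t [ cδ k ↦ α ])
  stage-step k {w} (inj₁ refl) with ch-cut α δ-free (word k) w (word≢[] k)
  ... | inj₁ e = inj₁ (trans (↦cδ≡↦ch (ch δ w) k) e)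
  ... | inj₂ (u , w≡ , e) = inj₂ (u , k , w≡ , trans (↦cδ≡↦ch (ch δ w) k) e)
  stage-step k (inj₂ c) = inj₂ (collapsed-step k c)

  stage-step-at : ∀ j w {t} → Stage (w ++ word j) t → Collapsed (w ++ word j) (t [ cδ j ↦ α ])
  stage-step-at j w (inj₁ refl) =
    w , j , refl , trans (↦cδ≡↦ch (ch δ (w ++ word j)) j) (ch-cut-suffix α δ-free w (word j))
  stage-step-at j w (inj₂ c) = collapsed-step j c

  collapse-collapsed : ∀ ks {w t} → Collapsed w t → Collapsed w (collapse t ks)
  collapse-collapsed [] c = c
  collapse-collapsed (k ∷ ks) c = collapse-collapsed ks (collapsed-step k c)

  collapse-stage : ∀ ks {w t} → Stage w t → Stage w (collapse t ks)
  collapse-stage [] s = s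
  collapse-stage (k ∷ ks) s = collapse-stage ks (stage-step k s)

  collapse-suffix : ∀ {j ks} w {t} → j ∈ ks → Stage (w ++ word j) t →
                    Collapsed (w ++ word j) (collapse t ks)
  collapse-suffix {j} {j ∷ ks} w (here refl) s = collapse-collapsed ks (stage-step-at j w s)
  collapse-suffix {ks = k ∷ ks} w (there j∈ks) s = collapse-suffix w j∈ks (stage-step k s)

  collapse-chain : ∀ j w → collapse (ch δ (w ++ word j)) (allFin n) ≡ ch α w
  collapse-chain j w with collapse-suffix w (∈-allFin j) (inj₁ refl)
  ... | u , i , w≡ , e = trans e (cong (ch α) (word-suffix-unique u w i j (sym w≡)))

  peel : Fin n → H → H
  peel m t = (t [ α ↦ δ ]) [ ⟨ γ , cδ m ⟩ ↦ γ ]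

  α↦δ-pair : ∀ L w → ⟨ L , τ α w ⟩ [ α ↦ δ ] ≡ ⟨ L [ α ↦ δ ] , ch δ w ⟩
  α↦δ-pair L w =
    trans (↦-pair (λ e → pair⋢ʳ (α⊑τα w) (subst (⟨ L , τ α w ⟩ ⊑_) e ⊑-refl)))
          (cong (⟨ L [ α ↦ δ ] ,_⟩) (trans (cong (_[ α ↦ δ ]) (τ≡ch α-free w)) (ch-rename δ α-free w)))

  α↦δ-base : ∀ m → ⟨ γ , cα m ⟩ [ α ↦ δ ] ≡ ⟨ γ , cδ m ⟩
  α↦δ-base m = trans (α↦δ-pair γ (word m)) (cong₂ ⟨_,_⟩ (↦-absent γ α⋢γ) (sym (cδ≡ch m)))

  peel-base : ∀ m → peel m ⟨ γ , cα m ⟩ ≡ γ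
  peel-base m = trans (cong (_[ ⟨ γ , cδ m ⟩ ↦ γ ]) (α↦δ-base m)) (↦-self _ γ)

  peel-pair : ∀ m L w → ⟨ L [ α ↦ δ ] , ch δ w ⟩ ≢ ⟨ γ , cδ m ⟩ →
              peel m ⟨ L , τ α w ⟩ ≡ ⟨ peel m L , ch δ w ⟩
  peel-pair m L w ne =
    trans (cong (_[ ⟨ γ , cδ m ⟩ ↦ γ ]) (α↦δ-pair L w))
          (trans (↦-pair ne) (cong (⟨ peel m L ,_⟩) (↦-absent (ch δ w) base⋢chain)))
    where
    base⋢chain : ¬ (⟨ γ , cδ m ⟩ ⊑ ch δ w)
    base⋢chain p = pair⋢ʳ (δ⊑cδ m) (pair⊑ch⇒⊑base δ-free (δ⊑cδ m) w p)

  collapse-peel-pair : ∀ m L w → ⟨ L [ α ↦ δ ] , ch δ w ⟩ ≢ ⟨ γ , cδ m ⟩ →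
                       collapse (peel m ⟨ L , τ α w ⟩) (allFin n) ≡
                       ⟨ collapse (peel m L) (allFin n) , collapse (ch δ w) (allFin n) ⟩
  collapse-peel-pair m L w ne =
    trans (cong (λ t → collapse t (allFin n)) (peel-pair m L w ne))
          (collapse-pair _ _ (allFin n) (⊑-trans α⊑δ (⊑-ch w)))

  collapse-γ : collapse γ (allFin n) ≡ γ
  collapse-γ = collapse-absent γ (allFin n) (λ k p → δ⋢γ (⊑-trans (δ⊑cδ k) p))

  Characterised : H → Set
  Characterised T =
    ¬ (δ ⊑ T) ×
    Σ (Fin n) (λ m → (⟨ γ , cα m ⟩ ⊑ T) ×
      Σ (List (Letter n)) (λ w → T ≡ ⟨ collapse (peel m T) (allFin n) , τ α w ⟩))

  baseIndex : ∀ {T} → P C α γ T → Fin n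
  baseIndex (base i) = i
  baseIndex (step _ _ _ _ p) = baseIndex p

  P⇒base⊑ : ∀ {T} (p : P C α γ T) → ⟨ γ , cα (baseIndex p) ⟩ ⊑ T
  P⇒base⊑ (base i) = ⊑-refl
  P⇒base⊑ (step _ _ _ _ p) = ⊑-l (P⇒base⊑ p)

  δ⋢pair : ∀ {x} w → ¬ (δ ⊑ x) → α ≢ x → ¬ (δ ⊑ ⟨ x , τ α w ⟩)
  δ⋢pair w δ⋢x α≢x p with ⊑-pair⁻ p
  ... | inj₁ e = α≢x (cong left e)
  ... | inj₂ (inj₁ q) = δ⋢x q
  ... | inj₂ (inj₂ q) = δ⋢τα w q

  P⇒δ⋢ : ∀ {T} → P C α γ T → ¬ (δ ⊑ T)
  P⇒δ⋢ (base i) = δ⋢pair (word i) δ⋢γ (λ e → α⋢γ (subst (α ⊑_) e ⊑-refl))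
  P⇒δ⋢ (step R i is j p) =
    δ⋢pair (concatMap (encOne C) (i ∷ is ++ [ j ])) (P⇒δ⋢ p)
           (λ e → γ⋢α (subst (γ ⊑_) (sym e) (⊑-trans (⊑-l ⊑-refl) (P⇒base⊑ p))))

  P⇒unfolds : ∀ {T} (p : P C α γ T) →
              Σ (List (Letter n)) (λ w → T ≡ ⟨ collapse (peel (baseIndex p) T) (allFin n) , τ α w ⟩)
  P⇒unfolds (base i) = word i , cong ⟨_, cα i ⟩ (sym (trans (cong (λ t → collapse t (allFin n)) (peel-base i)) collapse-γ))
  P⇒unfolds (step R i is j p) = w , cong ⟨_, τ α w ⟩ (sym collapse-peel-T)
    where
    m = baseIndex p
    u = concatMap (encOne C) (i ∷ is)
    w = concatMap (encOne C) (i ∷ is ++ [ j ])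
    T = ⟨ R , τ α u ⟩
    open ≡-Reasoning
    not-base : ⟨ T [ α ↦ δ ] , ch δ w ⟩ ≢ ⟨ γ , cδ m ⟩
    not-base e = δ⋢γ (subst (δ ⊑_) (cong left e) (↦-target⊑ δ (⊑-r (α⊑τα u))))
    collapse-peel-T : collapse (peel m ⟨ T , τ α w ⟩) (allFin n) ≡ T
    collapse-peel-T = begin
      collapse (peel m ⟨ T , τ α w ⟩) (allFin n)
        ≡⟨ collapse-peel-pair m T w not-base ⟩
      ⟨ collapse (peel m T) (allFin n) , collapse (ch δ w) (allFin n) ⟩
        ≡⟨ cong₂ ⟨_,_⟩ (sym (cong left (proj₂ (P⇒unfolds p))))
                       (cong (λ v → collapse (ch δ v) (allFin n)) (concatMap-++ (encOne C) (i ∷ is) [ j ])) ⟩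
      ⟨ R , collapse (ch δ (u ++ word j)) (allFin n) ⟩
        ≡⟨ cong ⟨ R ,_⟩ (trans (collapse-chain j u) (sym (τ≡ch α-free u))) ⟩
      T ∎

  P⇒characterised : ∀ {T} → P C α γ T → Characterised T
  P⇒characterised p = P⇒δ⋢ p , baseIndex p , P⇒base⊑ p , P⇒unfolds p

  P-shape : ∀ {T} → P C α γ T →
            Σ H (λ R → Σ (Fin n) (λ i → Σ (List (Fin n)) (λ is → T ≡ ⟨ R , encC C α (i ∷ is) ⟩)))
  P-shape (base i) = γ , i , [] , refl
  P-shape (step R i is j p) = _ , i , is ++ [ j ] , refl

  base⊑left : ∀ m L w → ⟨ L [ α ↦ δ ] , ch δ w ⟩ ≢ ⟨ γ , cδ m ⟩ →
              ⟨ γ , cα m ⟩ ⊑ ⟨ L , τ α w ⟩ → ⟨ γ , cα m ⟩ ⊑ L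
  base⊑left m L w ne sub with ⊑-pair⁻ sub
  ... | inj₁ e = ⊥-elim (ne (trans (sym (α↦δ-pair L w)) (trans (cong (_[ α ↦ δ ]) (sym e)) (α↦δ-base m))))
  ... | inj₂ (inj₁ q) = q
  ... | inj₂ (inj₂ q) =
    ⊥-elim (γ⋢α (⊑-trans (⊑-l ⊑-refl)
      (pair⊑ch⇒⊑base α-free (α⊑τα (word m)) w (subst (_ ⊑_) (τ≡ch α-free w) q))))

  base-case : ∀ m L w → ⟨ L [ α ↦ δ ] , ch δ w ⟩ ≡ ⟨ γ , cδ m ⟩ →
              L ≡ collapse (peel m ⟨ L , τ α w ⟩) (allFin n) → ⟨ L , τ α w ⟩ ≡ ⟨ γ , cα m ⟩
  base-case m L w e eqL = cong₂ ⟨_,_⟩ L≡γ (cong (τ α) w≡)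
    where
    peel≡γ : peel m ⟨ L , τ α w ⟩ ≡ γ
    peel≡γ = trans (cong (_[ ⟨ γ , cδ m ⟩ ↦ γ ]) (trans (α↦δ-pair L w) e)) (↦-self _ γ)
    L≡γ : L ≡ γ
    L≡γ = trans eqL (trans (cong (λ t → collapse t (allFin n)) peel≡γ) collapse-γ)
    w≡ : w ≡ word m
    w≡ = ch-injective w (word m) (trans (cong right e) (cδ≡ch m))

  -- Outside the base case, the right label must have lost a final block word k
  -- under the collapse, since otherwise δ would occur in L.
  left-unfolds : ∀ m L w → ¬ (δ ⊑ L) → ⟨ L [ α ↦ δ ] , ch δ w ⟩ ≢ ⟨ γ , cδ m ⟩ →
                 L ≡ collapse (peel m ⟨ L , τ α w ⟩) (allFin n) →
                 Σ (List (Letter n)) (λ u → Σ (Fin n) (λ k →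
                   w ≡ u ++ word k × L ≡ ⟨ collapse (peel m L) (allFin n) , τ α u ⟩))
  left-unfolds m L w δ⋢L ne eqL = from-stage (collapse-stage (allFin n) (inj₁ refl))
    where
    eqL′ : L ≡ ⟨ collapse (peel m L) (allFin n) , collapse (ch δ w) (allFin n) ⟩
    eqL′ = trans eqL (collapse-peel-pair m L w ne)
    from-stage : Stage w (collapse (ch δ w) (allFin n)) →
                 Σ (List (Letter n)) (λ u → Σ (Fin n) (λ k →
                   w ≡ u ++ word k × L ≡ ⟨ collapse (peel m L) (allFin n) , τ α u ⟩))
    from-stage (inj₁ e) = ⊥-elim (δ⋢L (subst (δ ⊑_) (sym eqL′) (⊑-r (subst (δ ⊑_) (sym e) (⊑-ch w)))))
    from-stage (inj₂ (u , k , w≡ , e)) = u , k , w≡ , trans eqL′ (cong ⟨ _ ,_⟩ (trans e (sym (τ≡ch α-free u))))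

  P-step : ∀ R u k → P C α γ ⟨ R , τ α u ⟩ → P C α γ ⟨ ⟨ R , τ α u ⟩ , τ α (u ++ word k) ⟩
  P-step R u k p with P-shape p
  ... | R' , i , is , e with cong left e | τα-injective u (concatMap (encOne C) (i ∷ is)) (cong right e)
  ... | refl | refl =
    subst (λ v → P C α γ ⟨ ⟨ R , τ α u ⟩ , τ α v ⟩) (concatMap-++ (encOne C) (i ∷ is) [ k ]) (step R i is k p)

  mutual
    unfolds⇒P : ∀ m T → ¬ (δ ⊑ T) → ⟨ γ , cα m ⟩ ⊑ T → (w : List (Letter n)) →
                T ≡ ⟨ collapse (peel m T) (allFin n) , τ α w ⟩ → P C α γ T
    unfolds⇒P m ⊥ₕ _ _ _ ()
    unfolds⇒P m ⟨ L , S ⟩ δ⋢T sub w eq = pair-unfolds⇒P m L w S (cong right eq) δ⋢T sub (cong left eq)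

    pair-unfolds⇒P : ∀ m L (w : List (Letter n)) S → S ≡ τ α w →
                     ¬ (δ ⊑ ⟨ L , S ⟩) → ⟨ γ , cα m ⟩ ⊑ ⟨ L , S ⟩ →
                     L ≡ collapse (peel m ⟨ L , S ⟩) (allFin n) → P C α γ ⟨ L , S ⟩
    pair-unfolds⇒P m L w .(τ α w) refl δ⋢T sub eqL = by-cases (⟨ L [ α ↦ δ ] , ch δ w ⟩ ≟H ⟨ γ , cδ m ⟩)
      where
      δ⋢L : ¬ (δ ⊑ L)
      δ⋢L p = δ⋢T (⊑-l p)
      by-cases : Dec (⟨ L [ α ↦ δ ] , ch δ w ⟩ ≡ ⟨ γ , cδ m ⟩) → P C α γ ⟨ L , τ α w ⟩
      by-cases (yes e) = subst (P C α γ) (sym (base-case m L w e eqL)) (base m)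
      by-cases (no ne) with left-unfolds m L w δ⋢L ne eqL
      ... | u , k , w≡ , eqL′ =
        subst (λ v → P C α γ ⟨ L , τ α v ⟩) (sym w≡)
          (subst (λ L → P C α γ ⟨ L , τ α (u ++ word k) ⟩) (sym eqL′)
            (P-step _ u k (subst (P C α γ) eqL′ (unfolds⇒P m L δ⋢L (base⊑left m L w ne sub) u eqL′))))

  characterised⇒P : ∀ {T} → Characterised T → P C α γ T
  characterised⇒P {T} (δ⋢T , m , sub , w , eq) = unfolds⇒P m T δ⋢T sub w eq

incomparable-g⇒CodeFree : ∀ {n α} → (∀ (i : ℕ) → 1 ≤ i → Incomparable α (g i)) → CodeFree n α
incomparable-g⇒CodeFree hg b0 = proj₁ (hg 1 (s≤s z≤n))
incomparable-g⇒CodeFree hg b1 = proj₁ (hg 2 (s≤s z≤n))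
incomparable-g⇒CodeFree hg (μ i) = proj₁ (hg (3 + toℕ i) (s≤s z≤n))

lemma4 : (n : ℕ) (C : Seq n) → (∀ i → C i ≢ []) →
         (α γ : H) → Incomparable α γ →
         (∀ (i : ℕ) → 1 ≤ i → Incomparable α (g i)) →
         (T : H) →
         let δ = ⟨ α , α ⟩ in
         P C α γ T ⇔
           ((¬ (δ ⊑ T)) ×
            Σ (Fin n) (λ m →
              (⟨ γ , encC C α [ m ] ⟩ ⊑ T) ×
              Σ (List (Letter n)) (λ w →
                T ≡ ⟨ replAll C δ α ((T [ α ↦ δ ]) [ ⟨ γ , encC C δ [ m ] ⟩ ↦ γ ]) , τ α w ⟩)))
lemma4 n C _ α γ (α⋢γ , γ⋢α) hg T = mk⇔ P⇒characterised characterised⇒P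
  where open Characterisation C α γ α⋢γ γ⋢α (incomparable-g⇒CodeFree hg)
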